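{- For $n\ge1$, let $t_n$ be the arbor consisting of a root vertex with one element to which $n-1$ leaves, each with one element, are directly attached. Then the poset $P_{t_n}$ has $2^{n-2}(n+3)$ elements (the number of vertices of the $n$-dimensional Hochschild polytope), and the $h$-vector of $t_n$ equals $(X+1)^{n-2}(X^2+(n+1)X+1)$ (the $h$-vector of the $n$-dimensional Hochschild polytope).
   Context: An arbor on a finite non-empty set $I$ is a rooted tree whose vertices are labeled by pairwise disjoint non-empty subsets of $I$ whose union is $I$; we identify a vertex with its label set. For a vertex $v$, $\mathscr{D}(v)$ is the union of the labels of all vertices whose path to the root passes through $v$ (including $v$). $P_t$ is the set of $a\in\mathbb{Z}^I$ with $a_i\ge0$ and $\sum_{i\in\mathscr{D}(v)}a_i\le|\mathscr{D}(v)|$ for every vertex $v$ (for $t_n$: $a\in\mathbb{Z}_{\ge0}^n$ with each leaf coordinate at most $1$ and total sum at most $n$). The $h$-vector of $t$ is $h_t(X)=\sum_{b\in P_t}X^{\mathrm{nz}(b)}$, where $\mathrm{nz}(b)$ is the number of non-zero coordinates of $b$. It is known that the $n$-dimensional Hochschild polytope (freehedron) has $2^{n-2}(n+3)$ vertices and $h$-vector $(X+1)^{n-2}(X^2+(n+1)X+1)$; for $n=1$ these expressions are read as $2$ and $X+1$. -}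

module Defs where

open import Data.Nat using (ℕ; zero; suc; _+_; _*_; _^_; _≤_)
open import Data.Fin using (Fin; zero; suc)
open import Data.List using (List; []; _∷_; _++_; map; length; allFin)
open import Data.Nat.ListAction using (sum)
open import Data.List.Relation.Unary.All using (All)
open import Data.Vec using (Vec; []; _∷_; lookup)
open import Data.Product using (Σ; _×_)
open import Relation.Binary.PropositionalEquality using (_≡_)

-- A rooted tree whose vertices are labelled by lists of elements of I = Fin n.
-- (An arbor is such a tree whose labels are disjoint non-empty and cover I.)
data Tree (n : ℕ) : Set where
  node : List (Fin n) → List (Tree n) → Tree n

mutual
  desc : ∀ {n} → Tree n → List (Fin n)
  desc (node l cs) = l ++ descs cs

  descs : ∀ {n} → List (Tree n) → List (Fin n)
  descs [] = []
  descs (c ∷ cs) = desc c ++ descs cs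

sumOver : ∀ {n} → Vec ℕ n → List (Fin n) → ℕ
sumOver a is = sum (map (lookup a) is)

-- a ∈ P_t : for every vertex v of t, Σ_{i ∈ 𝒟(v)} a_i ≤ |𝒟(v)|
-- (a_i ≥ 0 is automatic since a ∈ ℕ^n).
data InP {n : ℕ} (a : Vec ℕ n) : Tree n → Set where
  inP : ∀ {l cs} → sumOver a (desc (node l cs)) ≤ length (desc (node l cs))
        → All (InP a) cs → InP a (node l cs)

P : ∀ {n} → Tree n → Set
P {n} t = Σ (Vec ℕ n) (λ a → InP a t)

nz : ∀ {n} → Vec ℕ n → ℕ
nz [] = 0
nz (zero ∷ v) = nz v
nz (suc _ ∷ v) = suc (nz v)

Pnz : ∀ {n} → Tree n → ℕ → Set
Pnz {n} t k = Σ (Vec ℕ n) (λ a → InP a t × nz a ≡ k)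

-- t_n for n = suc m: root {0} with m leaves {1}, …, {m} attached.
tArbor : (m : ℕ) → Tree (suc m)
tArbor m = node (zero ∷ []) (map (λ i → node (suc i ∷ []) []) (allFin m))

-- Polynomials with ℕ coefficients as coefficient lists (constant term first).
Poly : Set
Poly = List ℕ

_⊕_ : Poly → Poly → Poly
[] ⊕ q = q
(x ∷ p) ⊕ [] = x ∷ p
(x ∷ p) ⊕ (y ∷ q) = (x + y) ∷ (p ⊕ q)

scale : ℕ → Poly → Poly
scale c p = map (c *_) p

_⊗_ : Poly → Poly → Poly
[] ⊗ q = []
(x ∷ p) ⊗ q = scale x q ⊕ (0 ∷ (p ⊗ q))

_^ₚ_ : Poly → ℕ → Poly
p ^ₚ zero = 1 ∷ []
p ^ₚ suc k = p ⊗ (p ^ₚ k)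

coeff : ℕ → Poly → ℕ
coeff k [] = 0
coeff zero (x ∷ p) = x
coeff (suc k) (x ∷ p) = coeff k p

-- h-vector of the n-dimensional Hochschild polytope, n = suc m:
-- (X+1)^(n-2) (X^2 + (n+1) X + 1), read as X + 1 for n = 1.
hochH : ℕ → Poly
hochH zero = 1 ∷ 1 ∷ []
hochH (suc k) = ((1 ∷ 1 ∷ []) ^ₚ k) ⊗ (1 ∷ (suc (suc k) + 1) ∷ 1 ∷ [])

-- number of vertices 2^(n-2) (n+3), n = suc m, read as 2 for n = 1.
hochV : ℕ → ℕ
hochV zero = 2
hochV (suc k) = 2 ^ k * (suc (suc k) + 3)

-- An element of P_{t_{m+1}} is a root value a₀ together with m leaf values in {0, 1}, subject
-- to a₀ + (number of leaves equal to 1) ≤ m + 1. Replace the bound m + 1 by m + e and split on the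
-- first leaf: a 0 changes nothing, a 1 uses up one unit of the bound and adds one non-zero
-- coordinate. So the polynomial G(m, e) counting these elements by number of non-zero
-- coordinates satisfies G(m+1, e) = G(m, e+1) + X·G(m, e), with G(0, e) = 1 + eX (only a₀ is
-- left). By induction G(m+1, e) = (1+X)^m (1 + (m+2+e)X + eX²); at e = 1 this is the h-vector of
-- the Hochschild polytope, and the number of elements is its value at X = 1.
module Submission where

open import Defs
open import Data.Nat using (ℕ; zero; suc; _+_; _*_; _^_; _≤_; _<_; z≤n; s≤s)
open import Data.Nat.Properties
  using ( +-comm; +-suc; +-identityʳ; *-comm; *-identityˡ; *-zeroʳ; *-distribˡ-+; *-distribʳ-+
        ; suc-injective; ≡-irrelevant; ≤-irrelevant; +-commutativeSemigroup )
open import Algebra.Properties.CommutativeSemigroup +-commutativeSemigroup using (interchange; x∙yz≈y∙xz)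
open import Data.Nat.Tactic.RingSolver using (solve-∀)
open import Data.Nat.ListAction using (sum)
open import Data.Fin using (Fin; zero; suc; toℕ; fromℕ<)
open import Data.Fin.Properties using (+↔⊎; toℕ<n; toℕ-fromℕ<; fromℕ<-toℕ)
open import Data.List using (List; []; _∷_; map; length; allFin)
open import Data.List.Properties using (map-∘; map-tabulate; length-map; length-tabulate)
import Data.List.Relation.Unary.All as List
import Data.List.Relation.Unary.All.Properties as List
open import Data.Vec using (Vec; []; _∷_; lookup)
import Data.Vec as Vec
open import Data.Vec.Relation.Unary.All using (All; []; _∷_)
import Data.Vec.Relation.Unary.All as All
open import Data.Vec.Relation.Unary.All.Properties using (lookup⁺; lookup⁻)
open import Data.Product using (Σ; _×_; _,_; proj₁)
open import Data.Product.Algebra using (Σ-assoc)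
open import Data.Product.Function.Dependent.Propositional using (Σ-↔)
open import Data.Sum using (_⊎_; inj₁; inj₂; [_,_]′)
open import Data.Sum.Function.Propositional using (_⊎-↔_)
open import Function using (_∘_; id)
open import Function.Bundles using (_↔_; _⇔_; mk↔ₛ′; mk⇔; Inverse; Equivalence)
open import Function.Properties.Inverse using (↔-refl; ↔-sym; ↔-trans)
open import Function.Related.TypeIsomorphisms using (Σ-distribʳ-⊎)
open import Relation.Binary.Bundles using (Setoid)
open import Relation.Binary.PropositionalEquality
  using (_≡_; refl; sym; trans; cong; cong₂; subst; subst₂; module ≡-Reasoning)
import Relation.Binary.Reasoning.Setoid as SetoidReasoning
open import Relation.Nullary using (Irrelevant)

-- Coefficient lists are not canonical (trailing zeros), so polynomials are compared coefficientwise.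
infix 4 _≈_
record _≈_ (p q : Poly) : Set where
  constructor coeffwise
  field coeff-≡ : ∀ k → coeff k p ≡ coeff k q
open _≈_

≈-setoid : Setoid _ _
≈-setoid = record
  { Carrier = Poly
  ; _≈_ = _≈_
  ; isEquivalence = record
    { refl  = coeffwise λ _ → refl
    ; sym   = λ p≈q → coeffwise λ k → sym (coeff-≡ p≈q k)
    ; trans = λ p≈q q≈r → coeffwise λ k → trans (coeff-≡ p≈q k) (coeff-≡ q≈r k)
    }
  }

open Setoid ≈-setoid using () renaming (refl to ≈-refl; sym to ≈-sym; trans to ≈-trans)
module ≈-Reasoning = SetoidReasoning ≈-setoid

coeff-⊕ : ∀ p q k → coeff k (p ⊕ q) ≡ coeff k p + coeff k q
coeff-⊕ []      q       k       = refl
coeff-⊕ (x ∷ p) []      k       = sym (+-identityʳ _)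
coeff-⊕ (x ∷ p) (y ∷ q) zero    = refl
coeff-⊕ (x ∷ p) (y ∷ q) (suc k) = coeff-⊕ p q k

coeff-scale : ∀ c p k → coeff k (scale c p) ≡ c * coeff k p
coeff-scale c []      k       = sym (*-zeroʳ c)
coeff-scale c (x ∷ p) zero    = refl
coeff-scale c (x ∷ p) (suc k) = coeff-scale c p k

coeff-∷⊗ : ∀ x p q k → coeff k ((x ∷ p) ⊗ q) ≡ x * coeff k q + coeff k (0 ∷ p ⊗ q)
coeff-∷⊗ x p q k = trans (coeff-⊕ (scale x q) _ k) (cong (_+ _) (coeff-scale x q k))

⊕-cong : ∀ {p p′ q q′} → p ≈ p′ → q ≈ q′ → p ⊕ q ≈ p′ ⊕ q′
⊕-cong {p} {p′} {q} {q′} p≈p′ q≈q′ = coeffwise λ k →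
  trans (coeff-⊕ p q k) (trans (cong₂ _+_ (coeff-≡ p≈p′ k) (coeff-≡ q≈q′ k)) (sym (coeff-⊕ p′ q′ k)))

∷-cong : ∀ a {p q} → p ≈ q → a ∷ p ≈ a ∷ q
∷-cong a p≈q = coeffwise λ { zero → refl ; (suc k) → coeff-≡ p≈q k }

scale-zero-⊕ : ∀ p q → scale 0 p ⊕ q ≈ q
scale-zero-⊕ p q = coeffwise λ k → trans (coeff-⊕ (scale 0 p) q k) (cong (_+ coeff k q) (coeff-scale 0 p k))

⊗-zeroʳ : ∀ p → p ⊗ [] ≈ []
⊗-zeroʳ []      = ≈-refl
⊗-zeroʳ (x ∷ p) = coeffwise λ { zero → refl ; (suc k) → coeff-≡ (⊗-zeroʳ p) k }

⊗-identityˡ : ∀ p → (1 ∷ []) ⊗ p ≈ p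
⊗-identityˡ p = coeffwise λ k →
  trans (coeff-∷⊗ 1 [] p k) (trans (cong₂ _+_ (*-identityˡ _) (coeff-0∷[] k)) (+-identityʳ _))
  where
  coeff-0∷[] : ∀ k → coeff k (0 ∷ []) ≡ 0
  coeff-0∷[] zero    = refl
  coeff-0∷[] (suc k) = refl

⊗-∷ʳ : ∀ p a q → p ⊗ (a ∷ q) ≈ scale a p ⊕ (0 ∷ p ⊗ q)
⊗-∷ʳ []      a q = coeffwise λ { zero → refl ; (suc k) → refl }
⊗-∷ʳ (x ∷ p) a q = coeffwise λ { zero → cong (_+ 0) (*-comm x a) ; (suc k) → step k }
  where
  open ≡-Reasoning
  step : ∀ k → coeff k (scale x q ⊕ (p ⊗ (a ∷ q))) ≡ coeff k (scale a p ⊕ ((x ∷ p) ⊗ q))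
  step k = begin
    coeff k (scale x q ⊕ (p ⊗ (a ∷ q)))
      ≡⟨ coeff-⊕ (scale x q) _ k ⟩
    coeff k (scale x q) + coeff k (p ⊗ (a ∷ q))
      ≡⟨ cong (coeff k (scale x q) +_) (trans (coeff-≡ (⊗-∷ʳ p a q) k) (coeff-⊕ (scale a p) _ k)) ⟩
    coeff k (scale x q) + (coeff k (scale a p) + coeff k (0 ∷ p ⊗ q))
      ≡⟨ x∙yz≈y∙xz (coeff k (scale x q)) (coeff k (scale a p)) (coeff k (0 ∷ p ⊗ q)) ⟩
    coeff k (scale a p) + (coeff k (scale x q) + coeff k (0 ∷ p ⊗ q))
      ≡⟨ cong (coeff k (scale a p) +_) (coeff-⊕ (scale x q) _ k) ⟨
    coeff k (scale a p) + coeff k ((x ∷ p) ⊗ q)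
      ≡⟨ coeff-⊕ (scale a p) _ k ⟨
    coeff k (scale a p ⊕ ((x ∷ p) ⊗ q)) ∎

⊗-comm : ∀ p q → p ⊗ q ≈ q ⊗ p
⊗-comm []      q = ≈-sym (⊗-zeroʳ q)
⊗-comm (x ∷ p) q = ≈-trans (⊕-cong ≈-refl (∷-cong 0 (⊗-comm p q))) (≈-sym (⊗-∷ʳ q x p))

⊗-congʳ : ∀ p {q q′} → q ≈ q′ → p ⊗ q ≈ p ⊗ q′
⊗-congʳ []      q≈q′ = ≈-refl
⊗-congʳ (x ∷ p) {q} {q′} q≈q′ = coeffwise λ k →
  trans (coeff-∷⊗ x p q k)
        (trans (cong₂ _+_ (cong (x *_) (coeff-≡ q≈q′ k)) (coeff-≡ (∷-cong 0 (⊗-congʳ p q≈q′)) k))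
               (sym (coeff-∷⊗ x p q′ k)))

⊗-congˡ : ∀ {p p′} q → p ≈ p′ → p ⊗ q ≈ p′ ⊗ q
⊗-congˡ {p} {p′} q p≈p′ = ≈-trans (⊗-comm p q) (≈-trans (⊗-congʳ q p≈p′) (⊗-comm q p′))

⊗-distribˡ-⊕ : ∀ p q r → p ⊗ (q ⊕ r) ≈ (p ⊗ q) ⊕ (p ⊗ r)
⊗-distribˡ-⊕ []      q r = ≈-refl
⊗-distribˡ-⊕ (x ∷ p) q r = coeffwise λ k → begin
  coeff k ((x ∷ p) ⊗ (q ⊕ r))
    ≡⟨ coeff-∷⊗ x p (q ⊕ r) k ⟩
  x * coeff k (q ⊕ r) + coeff k (0 ∷ p ⊗ (q ⊕ r))
    ≡⟨ cong₂ _+_ (cong (x *_) (coeff-⊕ q r k))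
                 (trans (coeff-≡ (∷-cong 0 (⊗-distribˡ-⊕ p q r)) k) (coeff-⊕ (0 ∷ p ⊗ q) (0 ∷ p ⊗ r) k)) ⟩
  x * (coeff k q + coeff k r) + (coeff k (0 ∷ p ⊗ q) + coeff k (0 ∷ p ⊗ r))
    ≡⟨ cong (_+ (coeff k (0 ∷ p ⊗ q) + coeff k (0 ∷ p ⊗ r))) (*-distribˡ-+ x (coeff k q) (coeff k r)) ⟩
  (x * coeff k q + x * coeff k r) + (coeff k (0 ∷ p ⊗ q) + coeff k (0 ∷ p ⊗ r))
    ≡⟨ interchange (x * coeff k q) _ _ _ ⟩
  (x * coeff k q + coeff k (0 ∷ p ⊗ q)) + (x * coeff k r + coeff k (0 ∷ p ⊗ r))
    ≡⟨ cong₂ _+_ (coeff-∷⊗ x p q k) (coeff-∷⊗ x p r k) ⟨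
  coeff k ((x ∷ p) ⊗ q) + coeff k ((x ∷ p) ⊗ r)
    ≡⟨ coeff-⊕ ((x ∷ p) ⊗ q) _ k ⟨
  coeff k (((x ∷ p) ⊗ q) ⊕ ((x ∷ p) ⊗ r)) ∎
  where open ≡-Reasoning

⊗-distribʳ-⊕ : ∀ p q r → (p ⊕ q) ⊗ r ≈ (p ⊗ r) ⊕ (q ⊗ r)
⊗-distribʳ-⊕ p q r =
  ≈-trans (⊗-comm (p ⊕ q) r) (≈-trans (⊗-distribˡ-⊕ r p q) (⊕-cong (⊗-comm r p) (⊗-comm r q)))

⊗-distrib-⊕-shift : ∀ p q r → p ⊗ (q ⊕ (0 ∷ r)) ≈ (p ⊗ q) ⊕ (0 ∷ p ⊗ r)
⊗-distrib-⊕-shift p q r =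
  ≈-trans (⊗-distribˡ-⊕ p q (0 ∷ r)) (⊕-cong ≈-refl (≈-trans (⊗-∷ʳ p 0 r) (scale-zero-⊕ p _)))

1+X-⊗ : ∀ p → (1 ∷ 1 ∷ []) ⊗ p ≈ p ⊕ (0 ∷ p)
1+X-⊗ p = coeffwise λ k →
  trans (coeff-∷⊗ 1 (1 ∷ []) p k)
        (trans (cong₂ _+_ (*-identityˡ _) (coeff-≡ (∷-cong 0 (⊗-identityˡ p)) k)) (sym (coeff-⊕ p (0 ∷ p) k)))

1+X-⊗-assoc : ∀ p q → ((1 ∷ 1 ∷ []) ⊗ p) ⊗ q ≈ p ⊗ ((1 ∷ 1 ∷ []) ⊗ q)
1+X-⊗-assoc p q = begin
  ((1 ∷ 1 ∷ []) ⊗ p) ⊗ q      ≈⟨ ⊗-congˡ q (1+X-⊗ p) ⟩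
  (p ⊕ (0 ∷ p)) ⊗ q           ≈⟨ ⊗-distribʳ-⊕ p (0 ∷ p) q ⟩
  (p ⊗ q) ⊕ ((0 ∷ p) ⊗ q)     ≈⟨ ⊕-cong (≈-refl {p ⊗ q}) (scale-zero-⊕ q _) ⟩
  (p ⊗ q) ⊕ (0 ∷ p ⊗ q)       ≈⟨ ⊗-distrib-⊕-shift p q q ⟨
  p ⊗ (q ⊕ (0 ∷ q))           ≈⟨ ⊗-congʳ p (1+X-⊗ q) ⟨
  p ⊗ ((1 ∷ 1 ∷ []) ⊗ q)      ∎
  where open ≈-Reasoning

sum-⊕ : ∀ p q → sum (p ⊕ q) ≡ sum p + sum q
sum-⊕ []      q       = refl
sum-⊕ (x ∷ p) []      = sym (+-identityʳ _)
sum-⊕ (x ∷ p) (y ∷ q) = trans (cong (x + y +_) (sum-⊕ p q)) (interchange x y (sum p) (sum q))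

sum-scale : ∀ c p → sum (scale c p) ≡ c * sum p
sum-scale c []      = sym (*-zeroʳ c)
sum-scale c (x ∷ p) = trans (cong (c * x +_) (sum-scale c p)) (sym (*-distribˡ-+ c x (sum p)))

sum-⊗ : ∀ p q → sum (p ⊗ q) ≡ sum p * sum q
sum-⊗ []      q = refl
sum-⊗ (x ∷ p) q = begin
  sum (scale x q ⊕ (0 ∷ p ⊗ q))      ≡⟨ sum-⊕ (scale x q) _ ⟩
  sum (scale x q) + sum (p ⊗ q)      ≡⟨ cong₂ _+_ (sum-scale x q) (sum-⊗ p q) ⟩
  x * sum q + sum p * sum q          ≡⟨ *-distribʳ-+ (sum q) x (sum p) ⟨
  (x + sum p) * sum q                ∎
  where open ≡-Reasoning

sum-^ₚ : ∀ p k → sum (p ^ₚ k) ≡ sum p ^ k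
sum-^ₚ p zero    = refl
sum-^ₚ p (suc k) = trans (sum-⊗ p (p ^ₚ k)) (cong (sum p *_) (sum-^ₚ p k))

sum-hochH : ∀ m → sum (hochH m) ≡ hochV m
sum-hochH zero    = refl
sum-hochH (suc k) =
  trans (sum-⊗ ((1 ∷ 1 ∷ []) ^ₚ k) _) (cong₂ _*_ (sum-^ₚ (1 ∷ 1 ∷ []) k) (sum-factor k))
  where
  sum-factor : ∀ k → 1 + (suc (suc k) + 1 + (1 + 0)) ≡ suc (suc k) + 3
  sum-factor = solve-∀

Fin-cong : ∀ {m n} → m ≡ n → Fin m ↔ Fin n
Fin-cong refl = ↔-refl

Fibre : {A : Set} → (A → ℕ) → ℕ → Set
Fibre {A} deg k = Σ A λ a → deg a ≡ k

record IsGenPoly {A : Set} (deg : A → ℕ) (p : Poly) : Set where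
  constructor byFibres
  field fibre↔ : ∀ k → Fibre deg k ↔ Fin (coeff k p)
open IsGenPoly

IsGenPoly-resp-≈ : ∀ {A : Set} {deg : A → ℕ} {p q} → p ≈ q → IsGenPoly deg p → IsGenPoly deg q
IsGenPoly-resp-≈ p≈q gp = byFibres λ k → ↔-trans (fibre↔ gp k) (Fin-cong (coeff-≡ p≈q k))

IsGenPoly-↔ : ∀ {A B : Set} {f : A → ℕ} {g : B → ℕ} {p} (e : A ↔ B) →
              (∀ a → g (Inverse.to e a) ≡ f a) → IsGenPoly f p → IsGenPoly g p
IsGenPoly-↔ {f = f} {g} e g∘e≡f gp = byFibres λ k →
  ↔-trans (↔-sym (Σ-↔ e λ {a} → fibre-cong a k)) (fibre↔ gp k)
  where
  fibre-cong : ∀ a k → (f a ≡ k) ↔ (g (Inverse.to e a) ≡ k)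
  fibre-cong a k = subst (λ n → (f a ≡ k) ↔ (n ≡ k)) (sym (g∘e≡f a)) ↔-refl

IsGenPoly-suc : ∀ {B : Set} {g : B → ℕ} {q} → IsGenPoly g q → IsGenPoly (suc ∘ g) (0 ∷ q)
IsGenPoly-suc {g = g} gp = byFibres λ
  { zero    → mk↔ₛ′ (λ ()) (λ ()) (λ ()) (λ ())
  ; (suc k) → ↔-trans (fibre-pred k) (fibre↔ gp k) }
  where
  fibre-pred : ∀ k → Fibre (suc ∘ g) (suc k) ↔ Fibre g k
  fibre-pred k = mk↔ₛ′ (λ (b , eq) → b , suc-injective eq) (λ (b , eq) → b , cong suc eq)
    (λ (b , eq) → cong (b ,_) (≡-irrelevant _ _)) (λ (b , eq) → cong (b ,_) (≡-irrelevant _ _))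

IsGenPoly-⊎ : ∀ {A B : Set} {f : A → ℕ} {g : B → ℕ} {p q} → IsGenPoly f p → IsGenPoly g q →
              IsGenPoly [ f , suc ∘ g ]′ (p ⊕ (0 ∷ q))
IsGenPoly-⊎ {p = p} {q} gp gq = byFibres λ k →
  ↔-trans Σ-distribʳ-⊎
    (↔-trans (fibre↔ gp k ⊎-↔ fibre↔ (IsGenPoly-suc gq) k)
      (↔-trans (↔-sym +↔⊎) (Fin-cong (sym (coeff-⊕ p (0 ∷ q) k)))))

Σℕ↔⊎ : {F : ℕ → Set} → Σ ℕ F ↔ (F zero ⊎ Σ ℕ (F ∘ suc))
Σℕ↔⊎ = mk↔ₛ′ to from
  (λ { (inj₁ x) → refl ; (inj₂ x) → refl }) (λ { (zero , x) → refl ; (suc k , x) → refl })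
  where
  to : Σ ℕ _ → _ ⊎ _
  to (zero  , x) = inj₁ x
  to (suc k , x) = inj₂ (k , x)
  from : _ ⊎ _ → Σ ℕ _
  from (inj₁ x)       = zero , x
  from (inj₂ (k , x)) = suc k , x

Σ-coeff↔Fin-sum : ∀ p → Σ ℕ (λ k → Fin (coeff k p)) ↔ Fin (sum p)
Σ-coeff↔Fin-sum []      = mk↔ₛ′ (λ ()) (λ ()) (λ ()) (λ ())
Σ-coeff↔Fin-sum (x ∷ p) = ↔-trans Σℕ↔⊎ (↔-trans (↔-refl ⊎-↔ Σ-coeff↔Fin-sum p) (↔-sym +↔⊎))

IsGenPoly⇒↔ : ∀ {A : Set} {deg : A → ℕ} {p} → IsGenPoly deg p → A ↔ Fin (sum p)
IsGenPoly⇒↔ {deg = deg} {p} gp =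
  ↔-trans byDegree (↔-trans (Σ-↔ ↔-refl (fibre↔ gp _)) (Σ-coeff↔Fin-sum p))
  where
  byDegree : _ ↔ Σ ℕ (Fibre deg)
  byDegree = mk↔ₛ′ (λ a → deg a , a , refl) (λ (_ , a , _) → a) (λ { (_ , a , refl) → refl }) (λ _ → refl)

<↔Fin : ∀ {c} → Σ ℕ (_< c) ↔ Fin c
<↔Fin = mk↔ₛ′ (λ (a , a<c) → fromℕ< a<c) (λ i → toℕ i , toℕ<n i) (λ i → fromℕ<-toℕ i (toℕ<n i))
  (λ (a , a<c) → bounded-≡ (toℕ-fromℕ< a<c))
  where
  bounded-≡ : ∀ {a b c} {a<c : a < c} {b<c : b < c} → a ≡ b → (a , a<c) ≡ (b , b<c)
  bounded-≡ refl = cong (_ ,_) (≤-irrelevant _ _)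

-- a₀ is the root coordinate and v the leaf coordinates of t_{m+1}; the root bound m + 1 becomes c.
Points : ℕ → ℕ → Set
Points m c = Σ ℕ λ a₀ → Σ (Vec ℕ m) λ v → All (_≤ 1) v × Vec.sum v + a₀ ≤ c

Points-nz : ∀ {m c} → Points m c → ℕ
Points-nz (a₀ , v , _) = nz (a₀ ∷ v)

Points₀-fibre : ∀ c k → Fibre (Points-nz {0} {c}) k ↔ Fin (coeff k (1 ∷ c ∷ []))
Points₀-fibre c zero = mk↔ₛ′ (λ _ → zero) (λ _ → (0 , [] , [] , z≤n) , refl) (λ { zero → refl })
  (λ { ((zero , [] , [] , z≤n) , refl) → refl ; ((suc _ , [] , [] , _) , ()) })
Points₀-fibre c (suc zero) = ↔-trans positive <↔Fin
  where
  positive : Fibre (Points-nz {0} {c}) 1 ↔ Σ ℕ (_< c)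
  positive = mk↔ₛ′ (λ { ((suc a , [] , [] , a<c) , refl) → a , a<c ; ((zero , [] , [] , _) , ()) })
    (λ (a , a<c) → (suc a , [] , [] , a<c) , refl) (λ _ → refl)
    (λ { ((suc a , [] , [] , a<c) , refl) → refl ; ((zero , [] , [] , _) , ()) })
Points₀-fibre c (suc (suc k)) = mk↔ₛ′ (λ { ((zero , [] , _) , ()) ; ((suc _ , [] , _) , ()) }) (λ ()) (λ ())
  (λ { ((zero , [] , _) , ()) ; ((suc _ , [] , _) , ()) })

nz-swap : ∀ {n} a b (v : Vec ℕ n) → nz (a ∷ b ∷ v) ≡ nz (b ∷ a ∷ v)
nz-swap zero    zero    v = refl
nz-swap zero    (suc b) v = refl
nz-swap (suc a) zero    v = refl
nz-swap (suc a) (suc b) v = refl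

Points-split : ∀ m c → (Points m (suc c) ⊎ Points m c) ↔ Points (suc m) (suc c)
Points-split m c = mk↔ₛ′ to from to∘from (λ { (inj₁ _) → refl ; (inj₂ _) → refl })
  where
  to : Points m (suc c) ⊎ Points m c → Points (suc m) (suc c)
  to (inj₁ (a₀ , v , bits , le)) = a₀ , 0 ∷ v , z≤n ∷ bits , le
  to (inj₂ (a₀ , v , bits , le)) = a₀ , 1 ∷ v , s≤s z≤n ∷ bits , s≤s le
  from : Points (suc m) (suc c) → Points m (suc c) ⊎ Points m c
  from (a₀ , zero ∷ v , z≤n ∷ bits , le)             = inj₁ (a₀ , v , bits , le)
  from (a₀ , suc zero ∷ v , s≤s z≤n ∷ bits , s≤s le) = inj₂ (a₀ , v , bits , le)
  to∘from : ∀ x → to (from x) ≡ x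
  to∘from (a₀ , zero ∷ v , z≤n ∷ bits , le)             = refl
  to∘from (a₀ , suc zero ∷ v , s≤s z≤n ∷ bits , s≤s le) = refl

Points-split-nz : ∀ m c x →
                  Points-nz (Inverse.to (Points-split m c) x) ≡ [ Points-nz , suc ∘ Points-nz ]′ x
Points-split-nz m c (inj₁ (a₀ , v , _)) = nz-swap a₀ 0 v
Points-split-nz m c (inj₂ (a₀ , v , _)) = nz-swap a₀ 1 v

pointsPoly : ℕ → ℕ → Poly
pointsPoly zero    e = 1 ∷ e ∷ []
pointsPoly (suc m) e = pointsPoly m (suc e) ⊕ (0 ∷ pointsPoly m e)

Points-isGenPoly : ∀ m e → IsGenPoly (Points-nz {m} {m + e}) (pointsPoly m e)
Points-isGenPoly zero    e = byFibres (Points₀-fibre e)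
Points-isGenPoly (suc m) e =
  IsGenPoly-↔ (Points-split m (m + e)) (Points-split-nz m (m + e))
    (IsGenPoly-⊎ (subst (λ c → IsGenPoly (Points-nz {m} {c}) (pointsPoly m (suc e)))
                        (+-suc m e) (Points-isGenPoly m (suc e)))
                 (Points-isGenPoly m e))

quadratic : ℕ → ℕ → Poly
quadratic m e = 1 ∷ (suc (suc m) + e) ∷ e ∷ []

quadratic-step : ∀ m e →
  quadratic m (suc e) ⊕ (0 ∷ quadratic m e) ≡ quadratic (suc m) e ⊕ (0 ∷ quadratic (suc m) e)
quadratic-step m e = cong₂ (λ a b → 1 ∷ a ∷ b ∷ e ∷ [])
  (cong (λ n → suc (suc n) + 1) (+-suc m e)) (sym (+-suc e (suc (suc (m + e)))))

pointsPoly-closed : ∀ m e → pointsPoly (suc m) e ≈ ((1 ∷ 1 ∷ []) ^ₚ m) ⊗ quadratic m e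
pointsPoly-closed zero    e =
  ≈-sym (≈-trans (⊗-identityˡ (quadratic 0 e)) (coeffwise λ k → cong (coeff k) shape))
  where
  shape : quadratic 0 e ≡ pointsPoly 1 e
  shape = cong (λ n → 1 ∷ n ∷ e ∷ []) (+-comm 1 (suc e))
pointsPoly-closed (suc m) e = begin
  pointsPoly (suc m) (suc e) ⊕ (0 ∷ pointsPoly (suc m) e)
    ≈⟨ ⊕-cong (pointsPoly-closed m (suc e)) (∷-cong 0 (pointsPoly-closed m e)) ⟩
  (B ⊗ quadratic m (suc e)) ⊕ (0 ∷ B ⊗ quadratic m e)
    ≈⟨ ⊗-distrib-⊕-shift B (quadratic m (suc e)) (quadratic m e) ⟨
  B ⊗ (quadratic m (suc e) ⊕ (0 ∷ quadratic m e))
    ≡⟨ cong (B ⊗_) (quadratic-step m e) ⟩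
  B ⊗ (q ⊕ (0 ∷ q))
    ≈⟨ ⊗-congʳ B (1+X-⊗ q) ⟨
  B ⊗ ((1 ∷ 1 ∷ []) ⊗ q)
    ≈⟨ 1+X-⊗-assoc B q ⟨
  ((1 ∷ 1 ∷ []) ⊗ B) ⊗ q ∎
  where
  open ≈-Reasoning
  B = (1 ∷ 1 ∷ []) ^ₚ m
  q = quadratic (suc m) e

pointsPoly-hochH : ∀ m → pointsPoly m 1 ≈ hochH m
pointsPoly-hochH zero    = ≈-refl
pointsPoly-hochH (suc m) = pointsPoly-closed m 1

mutual
  InP-irrelevant : ∀ {n} {a : Vec ℕ n} {t} → Irrelevant (InP a t)
  InP-irrelevant (inP le ps) (inP le′ ps′) = cong₂ inP (≤-irrelevant le le′) (All-InP-irrelevant ps ps′)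

  All-InP-irrelevant : ∀ {n} {a : Vec ℕ n} {ts} → Irrelevant (List.All (InP a) ts)
  All-InP-irrelevant List.[]       List.[]         = refl
  All-InP-irrelevant (p List.∷ ps) (p′ List.∷ ps′) =
    cong₂ List._∷_ (InP-irrelevant p p′) (All-InP-irrelevant ps ps′)

leaf : ∀ {m} → Fin m → Tree (suc m)
leaf i = node (suc i ∷ []) []

desc-tArbor : ∀ m → desc (tArbor m) ≡ zero ∷ map suc (allFin m)
desc-tArbor m = cong (zero ∷_) (descs-leaves (allFin m))
  where
  descs-leaves : (is : List (Fin m)) → descs (map leaf is) ≡ map suc is
  descs-leaves []       = refl
  descs-leaves (i ∷ is) = cong (suc i ∷_) (descs-leaves is)

sum-lookup-allFin : ∀ {m} (v : Vec ℕ m) → sum (map (lookup v) (allFin m)) ≡ Vec.sum v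
sum-lookup-allFin []      = refl
sum-lookup-allFin (x ∷ v) =
  cong (x +_) (trans (cong sum (trans (map-tabulate suc (lookup (x ∷ v))) (sym (map-tabulate id (lookup v)))))
                     (sum-lookup-allFin v))

tArbor-root-sum : ∀ {m} a₀ (v : Vec ℕ m) → sumOver (a₀ ∷ v) (desc (tArbor m)) ≡ Vec.sum v + a₀
tArbor-root-sum {m} a₀ v = begin
  sumOver (a₀ ∷ v) (desc (tArbor m))               ≡⟨ cong (sumOver (a₀ ∷ v)) (desc-tArbor m) ⟩
  a₀ + sum (map (lookup (a₀ ∷ v)) (map suc (allFin m))) ≡⟨ cong (λ xs → a₀ + sum xs) (map-∘ (allFin m)) ⟨
  a₀ + sum (map (lookup v) (allFin m))             ≡⟨ cong (a₀ +_) (sum-lookup-allFin v) ⟩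
  a₀ + Vec.sum v                                   ≡⟨ +-comm a₀ (Vec.sum v) ⟩
  Vec.sum v + a₀                                   ∎
  where open ≡-Reasoning

tArbor-root-size : ∀ m → length (desc (tArbor m)) ≡ suc m
tArbor-root-size m =
  trans (cong length (desc-tArbor m)) (cong suc (trans (length-map suc (allFin m)) (length-tabulate id)))

InP-leaf⇔ : ∀ {m} a₀ (v : Vec ℕ m) i → InP (a₀ ∷ v) (leaf i) ⇔ lookup v i ≤ 1
InP-leaf⇔ a₀ v i = mk⇔ (λ { (inP le _) → subst (_≤ 1) (+-identityʳ _) le })
                       (λ le → inP (subst (_≤ 1) (sym (+-identityʳ _)) le) List.[])

InP-tArbor⇔ : ∀ {m} a₀ (v : Vec ℕ m) →
              InP (a₀ ∷ v) (tArbor m) ⇔ (All (_≤ 1) v × Vec.sum v + a₀ ≤ suc m)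
InP-tArbor⇔ {m} a₀ v = mk⇔
  (λ { (inP le leaves) →
         lookup⁻ (λ i → Equivalence.to (InP-leaf⇔ a₀ v i) (List.tabulate⁻ (List.map⁻ leaves) i))
       , subst₂ _≤_ (tArbor-root-sum a₀ v) (tArbor-root-size m) le })
  (λ (bits , le) →
       inP (subst₂ _≤_ (sym (tArbor-root-sum a₀ v)) (sym (tArbor-root-size m)) le)
           (List.map⁺ (List.tabulate⁺ (λ i → Equivalence.from (InP-leaf⇔ a₀ v i) (lookup⁺ bits i)))))

Points↔P : ∀ m → Points m (suc m) ↔ P (tArbor m)
Points↔P m = mk↔ₛ′
  (λ (a₀ , v , h) → a₀ ∷ v , Equivalence.from (InP-tArbor⇔ a₀ v) h)
  (λ { (a₀ ∷ v , h) → a₀ , v , Equivalence.to (InP-tArbor⇔ a₀ v) h })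
  (λ { (a₀ ∷ v , h) → cong (a₀ ∷ v ,_) (InP-irrelevant _ _) })
  (λ (a₀ , v , bits , le) →
     cong (λ h → a₀ , v , h) (cong₂ _,_ (All.irrelevant ≤-irrelevant _ _) (≤-irrelevant _ _)))

P-tArbor-isGenPoly : ∀ m → IsGenPoly (nz ∘ proj₁ {B = λ a → InP a (tArbor m)}) (hochH m)
P-tArbor-isGenPoly m =
  IsGenPoly-resp-≈ (pointsPoly-hochH m) (IsGenPoly-↔ (Points↔P m) (λ _ → refl) Points-isGenPoly′)
  where
  Points-isGenPoly′ : IsGenPoly (Points-nz {m} {suc m}) (pointsPoly m 1)
  Points-isGenPoly′ =
    subst (λ c → IsGenPoly (Points-nz {m} {c}) (pointsPoly m 1)) (+-comm m 1) (Points-isGenPoly m 1)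

proposition9p1 : (m : ℕ)
    → (P (tArbor m) ↔ Fin (hochV m))
      × ((k : ℕ) → Pnz (tArbor m) k ↔ Fin (coeff k (hochH m)))
proposition9p1 m =
    ↔-trans (IsGenPoly⇒↔ (P-tArbor-isGenPoly m)) (Fin-cong (sum-hochH m))
  , λ k → ↔-trans (↔-sym Σ-assoc) (fibre↔ (P-tArbor-isGenPoly m) k)
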